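{- Let $V$ be a finite set, $X=\{v_i: v\in V, i\in\{0,1\}\}$, $H\le\mathrm{Sym}(V)$ transitive, $y\in H$, $\varphi\in\mathrm{Aut}(H)$ with $\varphi^2=\iota_y$, $G^+=\mathrm{Diag}_\varphi(H\times H)$, $g=(y,1)\tau$ and $G=\langle G^+,g\rangle$. Suppose $\Gamma$ is a connected $4$-valent graph on $X$ with $G\le\mathrm{Aut}(\Gamma)$, $\Gamma$ $G$-oriented and $(\Gamma,G)$ basic of biquasiprimitive type, with biparts $\{v_0\}$ and $\{v_1\}$ being the orbits of $G^+$, and let $\alpha=u_0$ for some $u\in V$ with $\alpha^g=(u^y)_1\in\Gamma(\alpha)$. Fix the $G$-invariant orientation of the edges for which $(u^y)_1\in\Gamma_{in}(\alpha)$. Let $(z^{\varphi^{ -1}},z)\in G_\alpha$, with $z\in (H_u)^\varphi$, act fixed-point-freely on $\Gamma(\alpha)$. Then (a) $\Gamma_{in}(\alpha)=\{(u^y)_1,(u^{yz})_1\}$ and $\Gamma_{out}(\alpha)=\{u_1,(u^z)_1\}$; and (b) for $\gamma:=\alpha^{g^{ -1}}=u_1$, $\Gamma_{in}(\gamma)=\{u_0,(u^{yzy^{ -1}})_0\}$ and $\Gamma_{out}(\gamma)=\{(u^{y^{ -1}})_0,(u^{zy^{ -1}})_0\}$.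
   Context: $\Gamma$ is $G$-oriented if $G\le\mathrm{Aut}(\Gamma)$ is transitive on vertices and edges but not on arcs; then $G$ has two paired orbits on arcs, either of which gives a $G$-invariant orientation of the edges, and for a vertex $\gamma$, $\Gamma_{in}(\gamma)$ and $\Gamma_{out}(\gamma)$ are the sets of in- and out-neighbours (each of size $2$ when $\Gamma$ is $4$-valent). $(\Gamma,G)$ is basic of biquasiprimitive type if every nontrivial normal subgroup of $G$ has at most two vertex-orbits and some has exactly two. $\mathrm{Sym}(V)\wr\mathrm{Sym}(2)$ acts on $X$ with $(h_1,h_2)$: $v_0\mapsto (v^{h_1})_0$, $v_1\mapsto(v^{h_2})_1$ and $\tau: v_\varepsilon\mapsto v_{1-\varepsilon}$. $\iota_y$ is $h\mapsto y^{ -1}hy$; $\mathrm{Diag}_\varphi(H\times H)=\{(h,h^\varphi)\}$. $u^{w}$ denotes the image of $u$ under $w\in H$. -}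

module Defs where

open import Data.Nat using (ℕ)
open import Data.Fin using (Fin)
open import Data.Bool using (Bool; true; false; not)
open import Data.Product using (Σ; ∃; ∃-syntax; _×_; _,_; proj₁; proj₂)
open import Data.Sum using (_⊎_)
open import Relation.Nullary using (¬_)
open import Relation.Binary.PropositionalEquality using (_≡_; _≢_; refl; cong; trans; sym)
open import Relation.Binary.Construct.Closure.ReflexiveTransitive using (Star)
open import Function.Bundles using (Inverse; _↔_; mk↔ₛ′; _⇔_)
open import Function.Construct.Composition using (_↔-∘_)
open import Function.Construct.Symmetry using (↔-sym)
open import Function.Construct.Identity using (↔-id)

-- Permutations, acting on the RIGHT (paper convention):
--   x ^ σ  = image of x under σ,   x ^ (σ · τ) = (x ^ σ) ^ τ.

Sym : Set → Set
Sym A = A ↔ A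

module _ {A : Set} where

  infixl 8 _^_
  _^_ : A → Sym A → A
  x ^ σ = Inverse.to σ x

  infixl 7 _·_
  _·_ : Sym A → Sym A → Sym A
  σ · τ = τ ↔-∘ σ

  _⁻¹ : Sym A → Sym A
  σ ⁻¹ = ↔-sym σ

  idₛ : Sym A
  idₛ = ↔-id A

  infix 4 _≈_
  _≈_ : Sym A → Sym A → Set
  σ ≈ τ = ∀ x → x ^ σ ≡ x ^ τ

  record IsSubgroup (P : Sym A → Set) : Set where
    field
      resp : ∀ {σ τ} → σ ≈ τ → P σ → P τ
      id∈  : P idₛ
      ·∈   : ∀ {σ τ} → P σ → P τ → P (σ · τ)
      ⁻¹∈  : ∀ {σ} → P σ → P (σ ⁻¹)

  data Gen (S : Sym A → Set) : Sym A → Set where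
    gen  : ∀ {σ} → S σ → Gen S σ
    gid  : Gen S idₛ
    gmul : ∀ {σ τ} → Gen S σ → Gen S τ → Gen S (σ · τ)
    ginv : ∀ {σ} → Gen S σ → Gen S (σ ⁻¹)
    gresp : ∀ {σ τ} → σ ≈ τ → Gen S σ → Gen S τ

  Transitive : (Sym A → Set) → Set
  Transitive P = ∀ x y → ∃[ σ ] (P σ × x ^ σ ≡ y)

  -- φ is an automorphism of the subgroup H (φ given on Sym A, only its
  -- behaviour on H matters)
  record IsAut (H : Sym A → Set) (φ : Sym A → Sym A) : Set where
    field
      into  : ∀ {h} → H h → H (φ h)
      resp  : ∀ {h k} → H h → h ≈ k → φ h ≈ φ k
      hom   : ∀ {h k} → H h → H k → φ (h · k) ≈ φ h · φ k
      inj   : ∀ {h k} → H h → H k → φ h ≈ φ k → h ≈ k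
      onto  : ∀ {k} → H k → ∃[ h ] (H h × φ h ≈ k)

  record IsNontrivialNormal (G N : Sym A → Set) : Set where
    field
      subgroup   : IsSubgroup N
      ⊆G         : ∀ {σ} → N σ → G σ
      normal     : ∀ {σ n} → G σ → N n → N (σ ⁻¹ · n · σ)
      nontrivial : ∃[ n ] (N n × ¬ (n ≈ idₛ))

  Orbit : (Sym A → Set) → A → A → Set
  Orbit N a x = ∃[ n ] (N n × a ^ n ≡ x)

  AtMostTwoOrbits : (Sym A → Set) → Set
  AtMostTwoOrbits N = ∃[ a ] ∃[ b ] (∀ x → Orbit N a x ⊎ Orbit N b x)

  ExactlyTwoOrbits : (Sym A → Set) → Set
  ExactlyTwoOrbits N =
    ∃[ a ] ∃[ b ] (¬ Orbit N a b × (∀ x → Orbit N a x ⊎ Orbit N b x))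

  BasicBiquasiprimitive : (Sym A → Set) → Set₁
  BasicBiquasiprimitive G =
    (∀ N → IsNontrivialNormal G N → AtMostTwoOrbits N)
    × (∃[ N ] (IsNontrivialNormal G N × ExactlyTwoOrbits N))

  record IsSimpleGraph (E : A → A → Set) : Set where
    field
      symm    : ∀ {x y} → E x y → E y x
      irrefl  : ∀ {x} → ¬ E x x

  Connected : (A → A → Set) → Set
  Connected E = ∀ x y → Star E x y

  FourValent : (A → A → Set) → Set
  FourValent E = ∀ x → ∃[ a ] ∃[ b ] ∃[ c ] ∃[ d ]
    ( (a ≢ b × a ≢ c × a ≢ d × b ≢ c × b ≢ d × c ≢ d)
    × (∀ w → E x w ⇔ (w ≡ a ⊎ w ≡ b ⊎ w ≡ c ⊎ w ≡ d)) )

  AutomorphismsOf : (A → A → Set) → (Sym A → Set) → Set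
  AutomorphismsOf E G = ∀ {σ} → G σ → ∀ x y → E x y ⇔ E (x ^ σ) (y ^ σ)

  EdgeTransitive : (A → A → Set) → (Sym A → Set) → Set
  EdgeTransitive E G = ∀ x y x' y' → E x y → E x' y' →
    ∃[ σ ] (G σ × ((x ^ σ ≡ x' × y ^ σ ≡ y') ⊎ (x ^ σ ≡ y' × y ^ σ ≡ x')))

  ArcTransitive : (A → A → Set) → (Sym A → Set) → Set
  ArcTransitive E G = ∀ x y x' y' → E x y → E x' y' →
    ∃[ σ ] (G σ × x ^ σ ≡ x' × y ^ σ ≡ y')

  Oriented : (A → A → Set) → (Sym A → Set) → Set
  Oriented E G = Transitive G × EdgeTransitive E G × ¬ ArcTransitive E G

  -- The G-invariant orientation containing the arc β → α:
  -- Arc G β α x w  means (x , w) lies in the G-orbit of the arc (β , α).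
  Arc : (Sym A → Set) → A → A → A → A → Set
  Arc G β α x w = ∃[ σ ] (G σ × β ^ σ ≡ x × α ^ σ ≡ w)

  In : (Sym A → Set) → A → A → A → A → Set
  In G β α x w = Arc G β α w x

  Out : (Sym A → Set) → A → A → A → A → Set
  Out G β α x w = Arc G β α x w

  FixedPointFreeOn : (A → A → Set) → A → Sym A → Set
  FixedPointFreeOn E x σ = ∀ w → E x w → w ^ σ ≢ w

-- The set X = V × {0,1}  (false = 0, true = 1) and the wreath action

X : Set → Set
X V = V × Bool

module _ {V : Set} where

  infix 9 _₀ _₁
  _₀ : V → X V
  v ₀ = (v , false)

  _₁ : V → X V
  v ₁ = (v , true)

  private
    pr : Sym V → Sym V → X V → X V
    pr h₁ h₂ (v , false) = (v ^ h₁ , false)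
    pr h₁ h₂ (v , true)  = (v ^ h₂ , true)

    pr-inv : ∀ h₁ h₂ x → pr h₁ h₂ (pr (h₁ ⁻¹) (h₂ ⁻¹) x) ≡ x
    pr-inv h₁ h₂ (v , false) = cong (_, false) (Inverse.strictlyInverseˡ h₁ v)
    pr-inv h₁ h₂ (v , true)  = cong (_, true)  (Inverse.strictlyInverseˡ h₂ v)

    pr-inv′ : ∀ h₁ h₂ x → pr (h₁ ⁻¹) (h₂ ⁻¹) (pr h₁ h₂ x) ≡ x
    pr-inv′ h₁ h₂ (v , false) = cong (_, false) (Inverse.strictlyInverseʳ h₁ v)
    pr-inv′ h₁ h₂ (v , true)  = cong (_, true)  (Inverse.strictlyInverseʳ h₂ v)

    sw : X V → X V
    sw (v , b) = (v , not b)

    sw-inv : ∀ x → sw (sw x) ≡ x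
    sw-inv (v , false) = refl
    sw-inv (v , true)  = refl

  pairₛ : Sym V → Sym V → Sym (X V)
  pairₛ h₁ h₂ = mk↔ₛ′ (pr h₁ h₂) (pr (h₁ ⁻¹) (h₂ ⁻¹)) (pr-inv h₁ h₂) (pr-inv′ h₁ h₂)

  τ : Sym (X V)
  τ = mk↔ₛ′ sw sw sw-inv sw-inv

  Diag : (Sym V → Set) → (Sym V → Sym V) → Sym (X V) → Set
  Diag H φ σ = ∃[ h ] (H h × σ ≈ pairₛ h (φ h))

  gElt : Sym V → Sym (X V)
  gElt y = pairₛ y idₛ · τ

  GroupG : (Sym V → Set) → (Sym V → Sym V) → Sym V → Sym (X V) → Set
  GroupG H φ y = Gen (λ σ → Diag H φ σ ⊎ σ ≈ gElt y)

{-# OPTIONS --safe #-}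
-- σ = (h, z) fixes α = u₀ and moves every neighbour of α. The arc
-- β = (u^y)₁ → α, its image α → u₁ under g⁻¹, and the σ-images of both give
-- two in- and two out-neighbours of α. The two of each kind differ because σ
-- is fixed-point-free on Γ(α); an in- and an out-neighbour differ because an
-- edge carrying both orientations would make G arc-transitive. By 4-valence
-- these are all the neighbours of α. Part (b) is the image of (a) under g⁻¹.
module Submission where

open import Defs
open import Data.Nat using (ℕ; _≤_)
open import Data.Nat.Properties using (1+n≰n)
open import Data.Fin using (Fin)
open import Data.Bool using (false; true)
open import Data.Fin.Properties using (injective⇒≤) renaming (_≟_ to _≟ᶠ_)
open import Data.Bool.Properties using () renaming (_≟_ to _≟ᵇ_)
open import Data.Product using (_×_; _,_; ∃-syntax)
open import Data.Product.Properties using (≡-dec)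
open import Data.Sum using (_⊎_; inj₁; inj₂)
open import Data.Empty using (⊥; ⊥-elim)
open import Data.Vec using (Vec; []; _∷_; lookup)
open import Data.Vec.Membership.Propositional using (_∈_)
open import Data.Vec.Relation.Unary.Any using (here; there; index)
open import Data.Vec.Relation.Unary.Any.Properties using (lookup-index)
open import Data.Vec.Relation.Unary.All as All using (All; []; _∷_)
open import Data.Vec.Relation.Unary.All.Properties using (lookup⁺)
open import Data.Vec.Relation.Unary.AllPairs using ([]; _∷_)
open import Data.Vec.Relation.Unary.Unique.Propositional using (Unique)
open import Data.Vec.Relation.Unary.Unique.Propositional.Properties using (lookup-injective)
open import Relation.Nullary using (¬_; yes; no)
open import Relation.Binary.Definitions using (DecidableEquality)
open import Relation.Binary.PropositionalEquality
  using (_≡_; _≢_; refl; sym; trans; cong; subst; subst₂; module ≡-Reasoning)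
open import Function.Bundles using (Inverse; Injection; Equivalence; _⇔_; mk⇔)
open import Function.Properties.Inverse using (↔⇒↣)

module _ {A : Set} where

  Unique-⊆⇒≤ : ∀ {m n} {xs : Vec A m} {ys : Vec A n} →
               Unique xs → All (_∈ ys) xs → m ≤ n
  Unique-⊆⇒≤ {m} {n} {xs} {ys} xs! xs⊆ys = injective⇒≤ position-injective
    where
    position : Fin m → Fin n
    position i = index (lookup⁺ xs⊆ys i)

    position-injective : ∀ {i j} → position i ≡ position j → i ≡ j
    position-injective {i} {j} eq = lookup-injective xs! i j (begin
      lookup xs i          ≡⟨ lookup-index (lookup⁺ xs⊆ys i) ⟩
      lookup ys (position i) ≡⟨ cong (lookup ys) eq ⟩
      lookup ys (position j) ≡⟨ sym (lookup-index (lookup⁺ xs⊆ys j)) ⟩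
      lookup xs j          ∎)
      where open ≡-Reasoning

  ^-injective : (σ : Sym A) {x w : A} → x ^ σ ≡ w ^ σ → x ≡ w
  ^-injective σ = Injection.injective (↔⇒↣ σ)

pairₛ-congʳ : ∀ {V : Set} (h₁ : Sym V) {h₂ k₂ : Sym V} → h₂ ≈ k₂ → pairₛ h₁ h₂ ≈ pairₛ h₁ k₂
pairₛ-congʳ h₁ h₂≈k₂ (v , false) = refl
pairₛ-congʳ h₁ h₂≈k₂ (v , true)  = cong _₁ (h₂≈k₂ v)

Gen-isSubgroup : {A : Set} {S : Sym A → Set} → IsSubgroup (Gen S)
Gen-isSubgroup = record { resp = gresp ; id∈ = gid ; ·∈ = gmul ; ⁻¹∈ = ginv }

module _ {A : Set} {E : A → A → Set} where

  FourValent⇒¬5-distinct-neighbours : FourValent E → ∀ x {ws : Vec A 5} →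
                                      Unique ws → All (E x) ws → ⊥
  FourValent⇒¬5-distinct-neighbours four x ws! ws⊆Γx with four x
  ... | a , b , c , d , _ , Γx = 1+n≰n (Unique-⊆⇒≤ ws! (All.map listed ws⊆Γx))
    where
    listed : ∀ {w} → E x w → w ∈ a ∷ b ∷ c ∷ d ∷ []
    listed {w} xw with Equivalence.to (Γx w) xw
    ... | inj₁ w≡a               = here w≡a
    ... | inj₂ (inj₁ w≡b)        = there (here w≡b)
    ... | inj₂ (inj₂ (inj₁ w≡c)) = there (there (here w≡c))
    ... | inj₂ (inj₂ (inj₂ w≡d)) = there (there (there (here w≡d)))

  FourValent⇒pair-exhausts : DecidableEquality A → FourValent E → ∀ {x} {P Q : A → Set} →
    (∀ {w} → P w → E x w) → (∀ {w} → Q w → E x w) → (∀ {v w} → P v → Q w → v ≢ w) →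
    ∀ {p₁ p₂ q₁ q₂} → P p₁ → P p₂ → p₁ ≢ p₂ → Q q₁ → Q q₂ → q₁ ≢ q₂ →
    ∀ {w} → P w → w ≡ p₁ ⊎ w ≡ p₂
  FourValent⇒pair-exhausts _≟_ four {x} P⇒E Q⇒E P∩Q {p₁} {p₂} P₁ P₂ p₁≢p₂ Q₁ Q₂ q₁≢q₂ {w} Pw
    with w ≟ p₁ | w ≟ p₂
  ... | yes w≡p₁ | _        = inj₁ w≡p₁
  ... | no _     | yes w≡p₂ = inj₂ w≡p₂
  ... | no w≢p₁  | no w≢p₂  = ⊥-elim (FourValent⇒¬5-distinct-neighbours four x
        ( (w≢p₁ ∷ w≢p₂ ∷ P∩Q Pw Q₁ ∷ P∩Q Pw Q₂ ∷ [])
        ∷ (p₁≢p₂ ∷ P∩Q P₁ Q₁ ∷ P∩Q P₁ Q₂ ∷ [])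
        ∷ (P∩Q P₂ Q₁ ∷ P∩Q P₂ Q₂ ∷ [])
        ∷ (q₁≢q₂ ∷ [])
        ∷ [] ∷ [])
        (P⇒E Pw ∷ P⇒E P₁ ∷ P⇒E P₂ ∷ Q⇒E Q₁ ∷ Q⇒E Q₂ ∷ []))

module Orbital {A : Set} {G : Sym A → Set} (G-subgroup : IsSubgroup G) (β α : A) where
  open IsSubgroup G-subgroup

  Arc-base : Arc G β α β α
  Arc-base = idₛ , id∈ , refl , refl

  Arc-^ : ∀ {ρ x w} → G ρ → Arc G β α x w → Arc G β α (x ^ ρ) (w ^ ρ)
  Arc-^ Gρ (σ , Gσ , refl , refl) = _ , ·∈ Gσ Gρ , refl , refl

  Arc⇒E : ∀ {E} → AutomorphismsOf E G → E β α → ∀ {x w} → Arc G β α x w → E x w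
  Arc⇒E aut βα (σ , Gσ , refl , refl) = Equivalence.to (aut Gσ β α) βα

  Arc-between : ∀ {x w x′ w′} → Arc G β α x w → Arc G β α x′ w′ →
                ∃[ ρ ] (G ρ × x ^ ρ ≡ x′ × w ^ ρ ≡ w′)
  Arc-between (σ , Gσ , refl , refl) (σ′ , Gσ′ , refl , refl) =
    σ ⁻¹ · σ′ , ·∈ (⁻¹∈ Gσ) Gσ′ ,
    cong (_^ σ′) (Inverse.strictlyInverseʳ σ β) ,
    cong (_^ σ′) (Inverse.strictlyInverseʳ σ α)

  Arc-reverse : ∀ {x w} → Arc G β α x w → Arc G β α w x → Arc G β α α β
  Arc-reverse xw wx with Arc-between xw Arc-base
  ... | ρ , Gρ , xρ≡β , wρ≡α = subst₂ (Arc G β α) wρ≡α xρ≡β (Arc-^ Gρ wx)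

  Arc-of-edge : ∀ {E} → EdgeTransitive E G → E β α → Arc G β α α β →
                ∀ {a b} → E a b → Arc G β α a b
  Arc-of-edge edgeTransitive βα αβ {a} {b} ab with edgeTransitive β α a b βα ab
  ... | ρ , Gρ , inj₁ (βρ≡a , αρ≡b) = ρ , Gρ , βρ≡a , αρ≡b
  ... | ρ , Gρ , inj₂ (βρ≡b , αρ≡a) = subst₂ (Arc G β α) αρ≡a βρ≡b (Arc-^ Gρ αβ)

  Oriented⇒Arc-asym : ∀ {E} → Oriented E G → E β α →
                      ∀ {x w} → Arc G β α x w → ¬ Arc G β α w x
  Oriented⇒Arc-asym {E} (_ , edgeTransitive , ¬arcTransitive) βα xw wx =
    ¬arcTransitive λ a b a′ b′ ab a′b′ → Arc-between (toArc ab) (toArc a′b′)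
    where
    toArc : ∀ {a b} → E a b → Arc G β α a b
    toArc = Arc-of-edge edgeTransitive βα (Arc-reverse xw wx)

module Neighbourhood {A : Set} (_≟_ : DecidableEquality A) {E : A → A → Set} {G : Sym A → Set}
         (G-subgroup : IsSubgroup G) (simple : IsSimpleGraph E) (four : FourValent E)
         (aut : AutomorphismsOf E G) (oriented : Oriented E G) {β α : A} (βα : E β α) where
  open Orbital G-subgroup β α

  two-in-two-out⇒neighbourhood : ∀ {x i₁ i₂ o₁ o₂} →
    Arc G β α i₁ x → Arc G β α i₂ x → i₁ ≢ i₂ →
    Arc G β α x o₁ → Arc G β α x o₂ → o₁ ≢ o₂ →
    (∀ w → In G β α x w ⇔ (w ≡ i₁ ⊎ w ≡ i₂)) × (∀ w → Out G β α x w ⇔ (w ≡ o₁ ⊎ w ≡ o₂))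
  two-in-two-out⇒neighbourhood {x} in₁ in₂ i₁≢i₂ out₁ out₂ o₁≢o₂ =
    (λ w → mk⇔ (FourValent⇒pair-exhausts _≟_ four In⇒E Out⇒E In∩Out in₁ in₂ i₁≢i₂ out₁ out₂ o₁≢o₂)
               λ { (inj₁ refl) → in₁ ; (inj₂ refl) → in₂ }) ,
    (λ w → mk⇔ (FourValent⇒pair-exhausts _≟_ four Out⇒E In⇒E Out∩In out₁ out₂ o₁≢o₂ in₁ in₂ i₁≢i₂)
               λ { (inj₁ refl) → out₁ ; (inj₂ refl) → out₂ })
    where
    Out⇒E : ∀ {w} → Out G β α x w → E x w
    Out⇒E = Arc⇒E aut βα

    In⇒E : ∀ {w} → In G β α x w → E x w
    In⇒E wx = IsSimpleGraph.symm simple (Arc⇒E aut βα wx)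

    In∩Out : ∀ {v w} → In G β α x v → Out G β α x w → v ≢ w
    In∩Out vx xw refl = Oriented⇒Arc-asym oriented βα vx xw

    Out∩In : ∀ {v w} → Out G β α x v → In G β α x w → v ≢ w
    Out∩In xv wx refl = Oriented⇒Arc-asym oriented βα xv wx

lemma3p4 : (n : ℕ) (H : Sym (Fin n) → Set) (y : Sym (Fin n)) (φ : Sym (Fin n) → Sym (Fin n)) →
    IsSubgroup H → Transitive H → H y →
    IsAut H φ → (∀ h → H h → φ (φ h) ≈ y ⁻¹ · h · y) →
    (E : X (Fin n) → X (Fin n) → Set) →
    IsSimpleGraph E → Connected E → FourValent E →
    AutomorphismsOf E (GroupG H φ y) →
    Oriented E (GroupG H φ y) →
    BasicBiquasiprimitive (GroupG H φ y) →
    (u : Fin n) → u ₀ ^ gElt y ≡ (u ^ y) ₁ → E (u ₀) ((u ^ y) ₁) →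
    (h z : Sym (Fin n)) → H h → u ^ h ≡ u → z ≈ φ h →
    FixedPointFreeOn E (u ₀) (pairₛ h z) →
    ((∀ w → In (GroupG H φ y) ((u ^ y) ₁) (u ₀) (u ₀) w ⇔ (w ≡ (u ^ y) ₁ ⊎ w ≡ (u ^ y ^ z) ₁))
    × (∀ w → Out (GroupG H φ y) ((u ^ y) ₁) (u ₀) (u ₀) w ⇔ (w ≡ u ₁ ⊎ w ≡ (u ^ z) ₁)))
    × (u ₀ ^ (gElt y ⁻¹) ≡ u ₁
    × (∀ w → In (GroupG H φ y) ((u ^ y) ₁) (u ₀) (u ₀ ^ (gElt y ⁻¹)) w ⇔ (w ≡ u ₀ ⊎ w ≡ (u ^ y ^ z ^ (y ⁻¹)) ₀))
    × (∀ w → Out (GroupG H φ y) ((u ^ y) ₁) (u ₀) (u ₀ ^ (gElt y ⁻¹)) w ⇔ (w ≡ (u ^ (y ⁻¹)) ₀ ⊎ w ≡ (u ^ z ^ (y ⁻¹)) ₀)))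
lemma3p4 n H y φ _ _ _ _ _ E simple _ four aut oriented _ u _ αβ h z Hh uʰ≡u z≈φh fpf =
  two-in-two-out⇒neighbourhood in₁ in₂ i₁≢i₂ out₁ out₂ o₁≢o₂ ,
  refl ,
  two-in-two-out⇒neighbourhood out₁ (Arc-^ Gg⁻¹ in₂) i₁≢i₂-at-γ (Arc-^ Gg⁻¹ out₁) (Arc-^ Gg⁻¹ out₂) o₁≢o₂-at-γ
  where
  G : Sym (X (Fin n)) → Set
  G = GroupG H φ y
  α β : X (Fin n)
  α = u ₀
  β = (u ^ y) ₁
  g σ : Sym (X (Fin n))
  g = gElt y
  σ = pairₛ h z

  βα : E β α
  βα = IsSimpleGraph.symm simple αβ

  open Orbital (Gen-isSubgroup {S = λ ρ → Diag H φ ρ ⊎ ρ ≈ g}) β α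
  open Neighbourhood (≡-dec _≟ᶠ_ _≟ᵇ_) Gen-isSubgroup simple four aut oriented βα

  Gg⁻¹ : G (g ⁻¹)
  Gg⁻¹ = ginv (gen (inj₂ λ _ → refl))

  Gσ : G σ
  Gσ = gen (inj₁ (h , Hh , pairₛ-congʳ h z≈φh))

  ασ≡α : α ^ σ ≡ α
  ασ≡α = cong _₀ uʰ≡u

  in₁ : Arc G β α β α
  in₁ = Arc-base
  in₂ : Arc G β α (β ^ σ) α
  in₂ = subst (Arc G β α (β ^ σ)) ασ≡α (Arc-^ Gσ in₁)
  out₁ : Arc G β α α (u ₁)
  out₁ = subst (λ v → Arc G β α v (u ₁)) (cong _₀ (Inverse.strictlyInverseʳ y u)) (Arc-^ Gg⁻¹ in₁)
  out₂ : Arc G β α α ((u ^ z) ₁)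
  out₂ = subst (λ v → Arc G β α v ((u ^ z) ₁)) ασ≡α (Arc-^ Gσ out₁)

  i₁≢i₂ : β ≢ β ^ σ
  i₁≢i₂ β≡βσ = fpf β αβ (sym β≡βσ)
  o₁≢o₂ : u ₁ ≢ (u ^ z) ₁
  o₁≢o₂ u₁≡uᶻ₁ = fpf (u ₁) (Arc⇒E aut βα out₁) (sym u₁≡uᶻ₁)

  i₁≢i₂-at-γ : u ₀ ≢ (β ^ σ) ^ g ⁻¹
  i₁≢i₂-at-γ u₀≡βσg⁻¹ = i₁≢i₂ (^-injective (g ⁻¹) (trans (cong _₀ (Inverse.strictlyInverseʳ y u)) u₀≡βσg⁻¹))
  o₁≢o₂-at-γ : u ₁ ^ g ⁻¹ ≢ (u ^ z) ₁ ^ g ⁻¹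
  o₁≢o₂-at-γ u₁g⁻¹≡uᶻ₁g⁻¹ = o₁≢o₂ (^-injective (g ⁻¹) u₁g⁻¹≡uᶻ₁g⁻¹)
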